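{- For $n \ge 1$, $$|\mathscr{L}(n)| = 1 + \sum_{k=1}^{n-3} |\mathscr{L}(n,k)|.$$
   Context: All lattices are finite. Reducible element: join-reducible ($x = y\vee z$, $y,z \ne x$) or meet-reducible ($x = y\wedge z$, $y,z\neq x$). RC-lattice: finite lattice in which all reducible elements are pairwise comparable. Nullity of a finite poset: $m-n+c$ for its cover graph ($m$ covering pairs, $n$ elements, $c$ components). $\mathscr{L}(n)$: the set of isomorphism classes of RC-lattices on $n$ elements; $\mathscr{L}(n,k)$: the set of isomorphism classes of RC-lattices on $n$ elements of nullity $k$. An empty sum is $0$. -}

module Defs where

open import Data.Nat using (ℕ; zero; suc; _+_)
open import Data.Fin using (Fin)
open import Data.Bool using (Bool; T)
open import Data.Product using (Σ; ∃; _×_; _,_)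
open import Data.Sum using (_⊎_)
open import Data.Unit using (⊤)
open import Relation.Nullary using (¬_)
open import Relation.Binary.PropositionalEquality using (_≡_; _≢_)
open import Relation.Binary.Construct.Closure.ReflexiveTransitive using (Star)
open import Function.Bundles using (_↔_; Inverse)

Rel : ℕ → Set
Rel n = Fin n → Fin n → Bool

module _ {n : ℕ} (R : Rel n) where

  _≼_ : Fin n → Fin n → Set
  x ≼ y = T (R x y)

  _≺_ : Fin n → Fin n → Set
  x ≺ y = x ≼ y × x ≢ y

  record IsPartialOrder : Set where
    field
      refl    : ∀ x → x ≼ x
      antisym : ∀ x y → x ≼ y → y ≼ x → x ≡ y
      trans   : ∀ x y z → x ≼ y → y ≼ z → x ≼ z

  IsJoin : Fin n → Fin n → Fin n → Set
  IsJoin x y j = x ≼ j × y ≼ j × (∀ u → x ≼ u → y ≼ u → j ≼ u)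

  IsMeet : Fin n → Fin n → Fin n → Set
  IsMeet x y m = m ≼ x × m ≼ y × (∀ l → l ≼ x → l ≼ y → l ≼ m)

  record IsLattice : Set where
    field
      isPartialOrder : IsPartialOrder
      join : ∀ x y → ∃ λ j → IsJoin x y j
      meet : ∀ x y → ∃ λ m → IsMeet x y m

  JoinReducible : Fin n → Set
  JoinReducible x = ∃ λ y → ∃ λ z → IsJoin y z x × y ≢ x × z ≢ x

  MeetReducible : Fin n → Set
  MeetReducible x = ∃ λ y → ∃ λ z → IsMeet y z x × y ≢ x × z ≢ x

  Reducible : Fin n → Set
  Reducible x = JoinReducible x ⊎ MeetReducible x

  IsRCLattice : Set
  IsRCLattice = IsLattice × (∀ x y → Reducible x → Reducible y → (x ≼ y ⊎ y ≼ x))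

  Covers : Fin n × Fin n → Set
  Covers (x , y) = x ≺ y × (∀ z → ¬ (x ≺ z × z ≺ y))

  Adjacent : Fin n → Fin n → Set
  Adjacent x y = Covers (x , y) ⊎ Covers (y , x)

  Connected : Fin n → Fin n → Set
  Connected = Star Adjacent

-- "The number of classes of the relation _~_ among elements satisfying P
-- is m": there are m representatives satisfying P, pairwise inequivalent,
-- and every element satisfying P is equivalent to one of them.
-- (With _~_ = _≡_ this says the set {a | P a} has exactly m elements.)
NumClasses : {A : Set} → (A → Set) → (A → A → Set) → ℕ → Set
NumClasses {A} P _~_ m =
  Σ (Fin m → A) λ r →
    (∀ i → P (r i)) ×
    (∀ i j → r i ~ r j → i ≡ j) ×
    (∀ a → P a → ∃ λ i → a ~ r i)

-- Nullity of the poset R: m - n + c, where m = number of covering pairs,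
-- c = number of connected components of the cover graph.
-- Stated without truncated subtraction as m + c ≡ n + k.
HasNullity : {n : ℕ} → Rel n → ℕ → Set
HasNullity {n} R k =
  ∃ λ m → ∃ λ c →
    NumClasses (Covers R) _≡_ m ×
    NumClasses {Fin n} (λ _ → ⊤) (Connected R) c ×
    m + c ≡ n + k

Iso : {n : ℕ} → Rel n → Rel n → Set
Iso {n} R S = Σ (Fin n ↔ Fin n) λ σ →
  ∀ x y → R x y ≡ S (Inverse.to σ x) (Inverse.to σ y)

sum1to : ℕ → (ℕ → ℕ) → ℕ
sum1to zero    b = 0
sum1to (suc N) b = sum1to N b + b (suc N)

{-# OPTIONS --safe #-}
module Submission where

-- A finite lattice has a top, so its cover graph is connected and its nullity is
-- m + 1 - n, where m is the number of covers.  Choosing an upper cover for every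
-- element but the top gives m ≥ n - 1, and the meet of two incomparable elements
-- has two upper covers, so equality holds exactly for chains, which are all
-- isomorphic.  In an RC-lattice a cover x ⋖ y is determined by x when x is
-- meet-irreducible, and by y otherwise, because the meet-reducible elements form a
-- chain.  The lower ends so used avoid the top and the meet of an incomparable
-- pair, the upper ends avoid the top and the bottom, hence m ≤ 2n - 4 and the
-- nullity is at most n - 3.  Counting isomorphism classes by nullity gives the
-- formula, the 1 being the class of the n-element chain.

open import Defs
open import Data.Nat using (ℕ; zero; suc; _+_; _∸_; _≤_; _<_; z≤n; s≤s; s≤s⁻¹)
open import Data.Nat.Properties
  using (≤-antisym; ≤-refl; <⇒≤; <⇒≱; <-irrefl; +-comm; +-assoc; +-identityʳ; +-cancelˡ-≡; +-cancelˡ-≤;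
         n≤0⇒n≡0; 1+n≰n; ≤-reflexive; m+[n∸m]≡n; m<n⇒m<1+n; m+n≤o⇒m≤o∸n; m<1+n⇒m<n∨m≡n; 0≢1+n; module ≤-Reasoning)
import Data.Nat.Properties as ℕ
open import Data.Fin as Fin using (Fin; zero; suc; toℕ; fromℕ<; punchOut; _↑ˡ_; _↑ʳ_)
open import Data.Fin.Properties
  using (_≟_; suc-injective; toℕ-fromℕ<; injective⇒≤; punchOut-injective; any?; all?; +↔⊎; *↔×)
import Data.Fin.Properties as Finₚ
open import Data.Fin.Induction using (po-wellFounded; po-noetherian)
open import Data.Fin.Subset using (Subset; _∈_; ∣_∣)
open import Data.Fin.Subset.Properties using (p⊂q⇒∣p∣<∣q∣; ∈⊤; ∣⊤∣≡n)
open import Data.Vec using (tabulate)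
open import Data.Vec.Properties using (lookup∘tabulate; []=⇒lookup; lookup⇒[]=)
open import Data.Vec.Functional using (_∷_; _++_)
open import Data.Vec.Functional.Properties using (lookup-++ˡ; lookup-++ʳ)
open import Data.Bool using (true; false; T)
open import Data.Bool.Properties using (T?; T-≡)
open import Data.Product using (∃; ∃₂; _×_; _,_; proj₁; proj₂)
import Data.Product as Product
open import Data.Product.Function.NonDependent.Propositional using (_×-↔_)
open import Data.Sum using (_⊎_; inj₁; inj₂; [_,_]; [_,_]′)
import Data.Sum as Sum
open import Data.Sum.Properties using (inj₁-injective; inj₂-injective)
open import Data.Unit using (⊤; tt)
open import Data.Empty using (⊥-elim)
open import Function using (_∘_; id; flip)
open import Function.Bundles using (_↔_; Inverse; _⇔_; mk⇔; mk↔ₛ′; Equivalence; Injection)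
open import Function.Definitions using (Injective)
open import Function.Properties.Inverse using (↔-refl; ↔-sym; ↔-trans; ↔⇒↣)
open import Induction.WellFounded using (WellFounded; Acc; acc)
open import Relation.Binary.Definitions using (Total; Decidable)
import Relation.Binary.Structures as B
import Relation.Binary.Construct.NonStrictToStrict as ToStrict
open import Relation.Binary.Construct.Closure.ReflexiveTransitive using (ε; _◅_; _◅◅_; reverse; gmap)
open import Relation.Binary.PropositionalEquality
  using (_≡_; _≢_; refl; sym; trans; cong; cong₂; subst; subst₂; ≢-sym; isEquivalence; module ≡-Reasoning)
open import Relation.Nullary using (¬_; Dec; yes; no)
open import Relation.Nullary.Decidable using (_×-dec_; _→-dec_; ¬?; ⌊_⌋; toWitness; fromWitness)
import Relation.Unary as U

to-injective : {A B : Set} (e : A ↔ B) → Injective _≡_ _≡_ (Inverse.to e)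
to-injective e = Injection.injective (↔⇒↣ e)

≡⇔to≡to : {A B : Set} (e : A ↔ B) → ∀ a a′ → a ≡ a′ ⇔ Inverse.to e a ≡ Inverse.to e a′
≡⇔to≡to e _ _ = mk⇔ (cong (Inverse.to e)) (to-injective e)

∷-injective : {A : Set} {m : ℕ} {x : A} {f : Fin m → A} →
  (∀ i → x ≢ f i) → Injective _≡_ _≡_ f → Injective _≡_ _≡_ (x ∷ f)
∷-injective _   _     {zero}  {zero}  _  = refl
∷-injective x∉f _     {zero}  {suc j} eq = ⊥-elim (x∉f j eq)
∷-injective x∉f _     {suc i} {zero}  eq = ⊥-elim (x∉f i (sym eq))
∷-injective _   f-inj {suc i} {suc j} eq = cong suc (f-inj eq)

injective∧missing⇒< : ∀ {m n} {f : Fin m → Fin n} {y : Fin n} →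
  Injective _≡_ _≡_ f → (∀ i → f i ≢ y) → m < n
injective∧missing⇒< {n = suc n} {f} {y} f-inj missing = s≤s (injective⇒≤ punchOut∘f-injective)
  where
  y≢f : ∀ i → y ≢ f i
  y≢f i = missing i ∘ sym
  punchOut∘f-injective : Injective _≡_ _≡_ (λ i → punchOut (y≢f i))
  punchOut∘f-injective {i} {j} eq = f-inj (punchOut-injective (y≢f i) (y≢f j) eq)

injective⇒↔ : ∀ {n} {f : Fin n → Fin n} → Injective _≡_ _≡_ f → Fin n ↔ Fin n
injective⇒↔ {f = f} f-inj =
  mk↔ₛ′ f (proj₁ ∘ preimage) (proj₂ ∘ preimage) (λ x → f-inj (proj₂ (preimage (f x))))
  where
  preimage : ∀ y → ∃ λ x → f x ≡ y
  preimage y with any? (λ x → f x ≟ y)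
  ... | yes found = found
  ... | no none   = ⊥-elim (<-irrefl refl (injective∧missing⇒< f-inj (λ x eq → none (x , eq))))

T-injective : ∀ {a b} → (T a → T b) → (T b → T a) → a ≡ b
T-injective {false} {false} _   _   = refl
T-injective {false} {true}  _   b⇒a = ⊥-elim (b⇒a tt)
T-injective {true}  {false} a⇒b _   = ⊥-elim (a⇒b tt)
T-injective {true}  {true}  _   _   = refl

∈-tabulate-⌊⌋ : ∀ {n} {P : Fin n → Set} (P? : U.Decidable P) {x} → x ∈ tabulate (⌊_⌋ ∘ P?) ⇔ P x
∈-tabulate-⌊⌋ P? {x} = mk⇔
  (λ x∈ → toWitness (Equivalence.from T-≡ (trans (sym (lookup∘tabulate _ x)) ([]=⇒lookup x∈))))
  (λ P-x → lookup⇒[]= x _ (trans (lookup∘tabulate _ x) (Equivalence.to T-≡ (fromWitness P-x))))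

module _ {A : Set} {_~_ : A → A → Set} where

  numClasses-empty : ∀ {P : A → Set} → (∀ a → ¬ P a) → NumClasses P _~_ 0
  numClasses-empty ¬P = (λ ()) , (λ ()) , (λ ()) , λ a → ⊥-elim ∘ ¬P a

  numClasses-one : ∀ {P : A → Set} {a} → P a → (∀ b → P b → b ~ a) → NumClasses P _~_ 1
  numClasses-one P-a all~a = (λ _ → _) , (λ _ → P-a) , (λ { zero zero _ → refl }) , λ b P-b → zero , all~a b P-b

numClasses-↔ : {A B : Set} {P : A → Set} {Q : B → Set} {_~_ : A → A → Set} {_≈_ : B → B → Set} {m : ℕ} →
  (e : A ↔ B) → (∀ a → P a ⇔ Q (Inverse.to e a)) → (∀ a a′ → a ~ a′ ⇔ Inverse.to e a ≈ Inverse.to e a′) →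
  NumClasses P _~_ m → NumClasses Q _≈_ m
numClasses-↔ {Q = Q} {_≈_ = _≈_} e P⇔Q ~⇔≈ (r , P-r , r-inj , r-cov) =
  to ∘ r , (λ i → Equivalence.to (P⇔Q (r i)) (P-r i)) , (λ i j → r-inj i j ∘ Equivalence.from (~⇔≈ _ _)) , cov
  where
  open Inverse e
  cov : ∀ b → Q b → ∃ λ i → b ≈ to (r i)
  cov b Q-b
    with i , from-b~ ← r-cov (from b) (Equivalence.from (P⇔Q (from b)) (subst Q (sym (strictlyInverseˡ b)) Q-b)) =
    i , subst (_≈ to (r i)) (strictlyInverseˡ b) (Equivalence.to (~⇔≈ _ _) from-b~)

numClasses-⇔ : {A : Set} {P Q : A → Set} {_~_ : A → A → Set} {m : ℕ} →
  (∀ a → P a ⇔ Q a) → NumClasses P _~_ m → NumClasses Q _~_ m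
numClasses-⇔ {_~_ = _~_} P⇔Q = numClasses-↔ {_~_ = _~_} {_≈_ = _~_} ↔-refl P⇔Q (λ _ _ → mk⇔ id id)

numClasses-dec : ∀ {N} {P : Fin N → Set} → U.Decidable P → ∃ λ m → NumClasses P _≡_ m
numClasses-dec {zero} P? = 0 , numClasses-empty {_~_ = _≡_} (λ ())
numClasses-dec {suc N} {P} P? with numClasses-dec (P? ∘ suc) | P? zero
... | m , r , P-r , r-inj , r-cov | no ¬P0 = m , suc ∘ r , P-r , (λ i j → r-inj i j ∘ suc-injective) , cov
  where
  cov : ∀ x → P x → ∃ λ i → x ≡ suc (r i)
  cov zero    P-x = ⊥-elim (¬P0 P-x)
  cov (suc x) P-x = Product.map₂ (cong suc) (r-cov x P-x)
... | m , r , P-r , r-inj , r-cov | yes P0 = suc m , zero ∷ suc ∘ r , P-r′ , (λ _ _ → inj) , cov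
  where
  P-r′ : ∀ i → P ((zero ∷ suc ∘ r) i)
  P-r′ zero    = P0
  P-r′ (suc i) = P-r i
  inj : Injective _≡_ _≡_ (zero ∷ suc ∘ r)
  inj = ∷-injective (λ _ ()) (r-inj _ _ ∘ suc-injective)
  cov : ∀ x → P x → ∃ λ i → x ≡ (zero ∷ suc ∘ r) i
  cov zero    _   = zero , refl
  cov (suc x) P-x = Product.map suc (cong suc) (r-cov x P-x)

module _ {A : Set} {_~_ : A → A → Set} (~-isEquivalence : B.IsEquivalence _~_) where

  open B.IsEquivalence ~-isEquivalence using () renaming (sym to ~-sym; trans to ~-trans)

  numClasses-unique : ∀ {P : A → Set} {m m′} →
    NumClasses P _~_ m → NumClasses P _~_ m′ → m ≡ m′
  numClasses-unique {P} c c′ = ≤-antisym (≤-classes c c′) (≤-classes c′ c)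
    where
    ≤-classes : ∀ {m m′} → NumClasses P _~_ m → NumClasses P _~_ m′ → m ≤ m′
    ≤-classes (r , P-r , r-inj , _) (r′ , _ , _ , r′-cov) = injective⇒≤ {f = f} f-inj
      where
      f = λ i → proj₁ (r′-cov (r i) (P-r i))
      f-inj : Injective _≡_ _≡_ f
      f-inj {i} {j} fi≡fj = r-inj i j (~-trans (proj₂ (r′-cov (r i) (P-r i)))
        (subst (λ k → r′ k ~ r j) (sym fi≡fj) (~-sym (proj₂ (r′-cov (r j) (P-r j))))))

  numClasses-⊎ : ∀ {P Q : A → Set} {m m′} →
    NumClasses P _~_ m → NumClasses Q _~_ m′ → (∀ {a b} → P a → Q b → ¬ a ~ b) →
    NumClasses (λ a → P a ⊎ Q a) _~_ (m + m′)
  numClasses-⊎ {P} {Q} {m} {m′} (r , P-r , r-inj , r-cov) (s , Q-s , s-inj , s-cov) disjoint =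
    r ++ s , holds ∘ Fin.splitAt m ,
    (λ i j → to-injective +↔⊎ ∘ injective (Fin.splitAt m i) (Fin.splitAt m j)) , cov
    where
    rs : Fin m ⊎ Fin m′ → A
    rs = [ r , s ]′
    holds : ∀ u → P (rs u) ⊎ Q (rs u)
    holds = [ inj₁ ∘ P-r , inj₂ ∘ Q-s ]
    injective : ∀ u v → rs u ~ rs v → u ≡ v
    injective (inj₁ i) (inj₁ j) eq = cong inj₁ (r-inj i j eq)
    injective (inj₁ i) (inj₂ j) eq = ⊥-elim (disjoint (P-r i) (Q-s j) eq)
    injective (inj₂ i) (inj₁ j) eq = ⊥-elim (disjoint (P-r j) (Q-s i) (~-sym eq))
    injective (inj₂ i) (inj₂ j) eq = cong inj₂ (s-inj i j eq)
    cov : ∀ a → P a ⊎ Q a → ∃ λ i → a ~ (r ++ s) i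
    cov a (inj₁ P-a) with i , a~ ← r-cov a P-a = i ↑ˡ m′ , subst (a ~_) (sym (lookup-++ˡ r s i)) a~
    cov a (inj₂ Q-a) with i , a~ ← s-cov a Q-a = m ↑ʳ i , subst (a ~_) (sym (lookup-++ʳ r s i)) a~

  numClasses-⋃ : {P : ℕ → A → Set} {c : ℕ → ℕ} →
    (∀ k → NumClasses (P k) _~_ (c k)) → (∀ {k k′ a b} → P k a → P k′ b → a ~ b → k ≡ k′) →
    ∀ K → NumClasses (λ a → ∃ λ k → k < K × P (suc k) a) _~_ (sum1to K c)
  numClasses-⋃ classes disjoint zero = numClasses-empty {_~_ = _~_} λ { _ (_ , () , _) }
  numClasses-⋃ {P} classes disjoint (suc K) =
    numClasses-⇔ {_~_ = _~_} (λ a → mk⇔ merge split)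
      (numClasses-⊎ (numClasses-⋃ classes disjoint K) (classes (suc K))
        λ { (k , k<K , P-a) P-b a~b → <-irrefl (ℕ.suc-injective (disjoint P-a P-b a~b)) k<K })
    where
    merge : ∀ {a} → (∃ λ k → k < K × P (suc k) a) ⊎ P (suc K) a → ∃ λ k → k < suc K × P (suc k) a
    merge (inj₁ (k , k<K , P-a)) = k , m<n⇒m<1+n k<K , P-a
    merge (inj₂ P-a) = K , ≤-refl , P-a
    split : ∀ {a} → (∃ λ k → k < suc K × P (suc k) a) → (∃ λ k → k < K × P (suc k) a) ⊎ P (suc K) a
    split (k , k<1+K , P-a) with m<1+n⇒m<n∨m≡n k<1+K
    ... | inj₁ k<K  = inj₁ (k , k<K , P-a)
    ... | inj₂ refl = inj₂ P-a

dual : ∀ {n} {R : Rel n} → IsPartialOrder R → IsPartialOrder (flip R)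
dual po = record
  { refl    = P.refl
  ; antisym = λ x y x⊒y y⊒x → P.antisym x y y⊒x x⊒y
  ; trans   = λ x y z x⊒y y⊒z → P.trans z y x y⊒z x⊒y
  }
  where module P = IsPartialOrder po

module Order {n : ℕ} (R : Rel n) where

  infix 4 _⊑_ _⊏_ _⋖_ _⊑?_ _⊏?_

  _⊑_ _⊏_ _⋖_ : Fin n → Fin n → Set
  _⊑_ = _≼_ R
  _⊏_ = _≺_ R
  x ⋖ y = Covers R (x , y)

  _⊑?_ : Decidable _⊑_
  x ⊑? y = T? (R x y)

  _⊏?_ : Decidable _⊏_
  x ⊏? y = x ⊑? y ×-dec ¬? (x ≟ y)

  covers? : U.Decidable (Covers R)
  covers? (x , y) = x ⊏? y ×-dec all? (λ z → ¬? (x ⊏? z ×-dec z ⊏? y))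

  isMeet? : ∀ x y m → Dec (IsMeet R x y m)
  isMeet? x y m = m ⊑? x ×-dec m ⊑? y ×-dec all? (λ l → l ⊑? x →-dec l ⊑? y →-dec l ⊑? m)

  meetReducible? : U.Decidable (MeetReducible R)
  meetReducible? x = any? λ y → any? λ z → isMeet? y z x ×-dec ¬? (y ≟ x) ×-dec ¬? (z ≟ x)

  ReduciblesComparable : Set
  ReduciblesComparable = ∀ x y → Reducible R x → Reducible R y → x ⊑ y ⊎ y ⊑ x

  Incomparable : Fin n → Fin n → Set
  Incomparable x y = ¬ x ⊑ y × ¬ y ⊑ x

  total⊎incomparable : Total _⊑_ ⊎ ∃₂ Incomparable
  total⊎incomparable with any? (λ x → any? (λ y → ¬? (x ⊑? y) ×-dec ¬? (y ⊑? x)))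
  ... | yes (x , y , x∥y) = inj₂ (x , y , x∥y)
  ... | no none = inj₁ comparable
    where
    comparable : Total _⊑_
    comparable x y with x ⊑? y | y ⊑? x
    ... | yes x⊑y | _       = inj₁ x⊑y
    ... | no _    | yes y⊑x = inj₂ y⊑x
    ... | no x⋢y  | no y⋢x  = ⊥-elim (none (x , y , x⋢y , y⋢x))

  coverCount : ∃ λ m → NumClasses (Covers R) _≡_ m
  coverCount with m , covers ← numClasses-dec (covers? ∘ Inverse.to (*↔× {n} {n})) =
    m , numClasses-↔ {_~_ = _≡_} {_≈_ = _≡_} (*↔× {n} {n}) (λ _ → mk⇔ id id) (≡⇔to≡to *↔×) covers

  Connected-isEquivalence : B.IsEquivalence (Connected R)
  Connected-isEquivalence = record { refl = ε ; sym = reverse Sum.swap ; trans = _◅◅_ }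

  hasNullity-unique : ∀ {k k′} → HasNullity R k → HasNullity R k′ → k ≡ k′
  hasNullity-unique {k} {k′} (m , c , covers , components , eq) (m′ , c′ , covers′ , components′ , eq′) =
    +-cancelˡ-≡ n k k′ (begin
      n + k   ≡⟨ eq ⟨
      m + c   ≡⟨ cong₂ _+_ (numClasses-unique isEquivalence covers covers′)
                           (numClasses-unique Connected-isEquivalence components components′) ⟩
      m′ + c′ ≡⟨ eq′ ⟩
      n + k′  ∎)
    where open ≡-Reasoning

  module Poset (po : IsPartialOrder R) where

    open IsPartialOrder po public using ()
      renaming (refl to ⊑-refl; antisym to ⊑-antisym; trans to ⊑-trans)

    ⊑-isPartialOrder : B.IsPartialOrder _≡_ _⊑_
    ⊑-isPartialOrder = record
      { isPreorder = record
        { isEquivalence = isEquivalence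
        ; reflexive     = λ { refl → ⊑-refl _ }
        ; trans         = ⊑-trans _ _ _
        }
      ; antisym = ⊑-antisym _ _
      }

    open B.IsStrictPartialOrder (ToStrict.<-isStrictPartialOrder _≡_ _⊑_ ⊑-isPartialOrder) public
      using (irrefl) renaming (trans to ⊏-trans)

    ⊏-wellFounded : WellFounded _⊏_
    ⊏-wellFounded = po-wellFounded ⊑-isPartialOrder

    ⊏-noetherian : WellFounded (flip _⊏_)
    ⊏-noetherian = po-noetherian ⊑-isPartialOrder

    ⋖-⊏-⊑⇒≡ : ∀ {x y w} → x ⋖ y → x ⊏ w → w ⊑ y → w ≡ y
    ⋖-⊏-⊑⇒≡ {y = y} {w} (_ , nothing-between) x⊏w w⊑y with w ≟ y
    ... | yes w≡y = w≡y
    ... | no w≢y  = ⊥-elim (nothing-between w (x⊏w , w⊑y , w≢y))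

    ⋖-⊑-⊏⇒≡ : ∀ {x y w} → x ⋖ y → x ⊑ w → w ⊏ y → x ≡ w
    ⋖-⊑-⊏⇒≡ {x} {w = w} (_ , nothing-between) x⊑w w⊏y with x ≟ w
    ... | yes x≡w = x≡w
    ... | no x≢w  = ⊥-elim (nothing-between w ((x⊑w , x≢w) , w⊏y))

    cover-between : ∀ {x y} → x ⊏ y → ∃ λ z → x ⋖ z × z ⊑ y
    cover-between {x} {y} = go (⊏-wellFounded y)
      where
      go : ∀ {y} → Acc _⊏_ y → x ⊏ y → ∃ λ z → x ⋖ z × z ⊑ y
      go {y} (acc smaller) x⊏y with any? (λ w → x ⊏? w ×-dec w ⊏? y)
      ... | no nothing-between = y , (x⊏y , λ w → nothing-between ∘ (w ,_)) , ⊑-refl y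
      ... | yes (w , x⊏w , w⊏y) with z , x⋖z , z⊑w ← go (smaller w⊏y) x⊏w =
        z , x⋖z , ⊑-trans z w y z⊑w (proj₁ w⊏y)

    upperBound : (∀ x y → ∃ (IsJoin R x y)) → ∀ {k} (f : Fin k → Fin n) → Fin n → ∃ λ u → ∀ i → f i ⊑ u
    upperBound join {zero}  f x = x , λ ()
    upperBound join {suc k} f x =
      let u , f⊑u         = upperBound join (f ∘ suc) x
          j , f₀⊑j , u⊑j , _ = join (f zero) u
      in  j , λ { zero → f₀⊑j ; (suc i) → ⊑-trans _ _ _ (f⊑u i) u⊑j }

Iso-isEquivalence : ∀ {n} → B.IsEquivalence (Iso {n})
Iso-isEquivalence = record
  { refl  = ↔-refl , λ _ _ → refl
  ; sym   = λ {R} {S} → Iso-sym {R = R} {S}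
  ; trans = λ (σ , σ-ord) (τ , τ-ord) → ↔-trans σ τ , λ x y → trans (σ-ord x y) (τ-ord _ _)
  }
  where
  Iso-sym : ∀ {n} {R S : Rel n} → Iso R S → Iso S R
  Iso-sym {R = R} {S} (σ , σ-ord) = ↔-sym σ , λ x y → begin
      S x y                         ≡⟨ cong₂ S (strictlyInverseˡ x) (strictlyInverseˡ y) ⟨
      S (to (from x)) (to (from y)) ≡⟨ σ-ord (from x) (from y) ⟨
      R (from x) (from y)           ∎
    where
    open Inverse σ
    open ≡-Reasoning

module _ {n} {R S : Rel n} (iso : Iso R S) where

  private
    open Inverse (proj₁ iso)

    ⊑-preserved : ∀ {x y} → T (R x y) → T (S (to x) (to y))
    ⊑-preserved = subst T (proj₂ iso _ _)

    ⊑-reflected : ∀ {x y} → T (S (to x) (to y)) → T (R x y)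
    ⊑-reflected = subst T (sym (proj₂ iso _ _))

    ⊏-reflected : ∀ {x y} → _≺_ S (to x) (to y) → _≺_ R x y
    ⊏-reflected (x⊑y , x≢y) = ⊑-reflected x⊑y , x≢y ∘ cong to

  covers-preserved : ∀ {x y} → Covers R (x , y) → Covers S (to x , to y)
  covers-preserved {x} {y} ((x⊑y , x≢y) , nothing-between) =
    (⊑-preserved x⊑y , x≢y ∘ to-injective (proj₁ iso)) ,
    λ w between →
      let x⊏w , w⊏y = subst (λ v → _≺_ S (to x) v × _≺_ S v (to y)) (sym (strictlyInverseˡ w)) between
      in  nothing-between (from w) (⊏-reflected x⊏w , ⊏-reflected w⊏y)

  connected-preserved : ∀ {x y} → Connected R x y → Connected S (to x) (to y)
  connected-preserved = gmap to λ {x} {y} → Sum.map (covers-preserved {x} {y}) (covers-preserved {y} {x})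

hasNullity-transport : ∀ {n} {R S : Rel n} {k} → Iso R S → HasNullity R k → HasNullity S k
hasNullity-transport {n} {R} {S} iso@(σ , _) (m , c , covers , components , eq) =
  m , c , numClasses-↔ {_~_ = _≡_} {_≈_ = _≡_} (σ ×-↔ σ) covers⇔ (≡⇔to≡to (σ ×-↔ σ)) covers ,
          numClasses-↔ {_~_ = Connected R} {_≈_ = Connected S} σ (λ _ → mk⇔ id id) connected⇔ components , eq
  where
  open Inverse σ
  iso⁻¹ : Iso S R
  iso⁻¹ = B.IsEquivalence.sym Iso-isEquivalence iso
  back : (P : Fin n → Fin n → Set) → ∀ {x y} → P (from (to x)) (from (to y)) → P x y
  back P = subst₂ P (strictlyInverseʳ _) (strictlyInverseʳ _)
  covers⇔ : ∀ p → Covers R p ⇔ Covers S (Inverse.to (σ ×-↔ σ) p)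
  covers⇔ (x , y) = mk⇔ (covers-preserved {R = R} {S} iso)
    (back (λ a b → Covers R (a , b)) ∘ covers-preserved {R = S} {R} iso⁻¹)
  connected⇔ : ∀ x y → Connected R x y ⇔ Connected S (to x) (to y)
  connected⇔ x y = mk⇔ (connected-preserved {R = R} {S} iso)
    (back (Connected R) ∘ connected-preserved {R = S} {R} iso⁻¹)

hasNullity-iso : ∀ {n} {R S : Rel n} {k k′} → Iso R S → HasNullity R k → HasNullity S k′ → k ≡ k′
hasNullity-iso iso h h′ = Order.hasNullity-unique _ (hasNullity-transport iso h) h′

module FiniteLattice {n} {R : Rel n} (L : IsLattice R) (x₀ : Fin n) where

  open IsLattice L
  open Order R
  open Poset isPartialOrder

  top : Fin n
  top = proj₁ (upperBound join id x₀)

  top-greatest : ∀ x → x ⊑ top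
  top-greatest = proj₂ (upperBound join id x₀)

  bot : Fin n
  bot = proj₁ (Order.Poset.upperBound (flip R) (dual isPartialOrder) meet id x₀)

  bot-least : ∀ x → bot ⊑ x
  bot-least = proj₂ (Order.Poset.upperBound (flip R) (dual isPartialOrder) meet id x₀)

  ⋖⇒≢top : ∀ {x y} → x ⋖ y → x ≢ top
  ⋖⇒≢top {x} {y} ((x⊑y , x≢y) , _) refl = x≢y (⊑-antisym x y x⊑y (top-greatest y))

  ⋖⇒≢bot : ∀ {x y} → x ⋖ y → y ≢ bot
  ⋖⇒≢bot {x} {y} ((x⊑y , x≢y) , _) refl = x≢y (⊑-antisym x y x⊑y (bot-least x))

  upperCover : Fin n → Fin n
  upperCover x with x ≟ top
  ... | yes _    = top
  ... | no x≢top = proj₁ (cover-between (top-greatest x , x≢top))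

  ⋖-upperCover : ∀ {x} → x ≢ top → x ⋖ upperCover x
  ⋖-upperCover {x} x≢top with x ≟ top
  ... | yes x≡top = ⊥-elim (x≢top x≡top)
  ... | no x≢top′ = proj₁ (proj₂ (cover-between (top-greatest x , x≢top′)))

  connected-to-top : ∀ x → Connected R x top
  connected-to-top x = go (⊏-noetherian x)
    where
    go : ∀ {x} → Acc (flip _⊏_) x → Connected R x top
    go {x} (acc larger) with x ≟ top
    ... | yes refl = ε
    ... | no x≢top = inj₁ (⋖-upperCover x≢top) ◅ go (larger (proj₁ (⋖-upperCover x≢top)))

  oneComponent : NumClasses (λ _ → ⊤) (Connected R) 1
  oneComponent = numClasses-one {_~_ = Connected R} tt (λ x _ → connected-to-top x)

  upperCovers-distinct⇒meetReducible : ∀ {x y y′} → x ⋖ y → x ⋖ y′ → y ≢ y′ → MeetReducible R x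
  upperCovers-distinct⇒meetReducible {x} {y} {y′} x⋖y x⋖y′ y≢y′ with meet y y′
  ... | w , w-meet@(w⊑y , w⊑y′ , greatest) with x ≟ w
  ...   | yes refl = y , y′ , w-meet , ≢-sym (proj₂ (proj₁ x⋖y)) , ≢-sym (proj₂ (proj₁ x⋖y′))
  ...   | no x≢w   = ⊥-elim (y≢y′ (trans (sym (⋖-⊏-⊑⇒≡ x⋖y x⊏w w⊑y)) (⋖-⊏-⊑⇒≡ x⋖y′ x⊏w w⊑y′)))
    where
    x⊏w : x ⊏ w
    x⊏w = greatest x (proj₁ (proj₁ x⋖y)) (proj₁ (proj₁ x⋖y′)) , x≢w

  meetReducible⇒¬⋖top : ∀ {x} → MeetReducible R x → ¬ x ⋖ top
  meetReducible⇒¬⋖top {x} (y , z , (x⊑y , x⊑z , greatest) , y≢x , z≢x) x⋖top =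
    proj₂ (proj₁ x⋖top) (⊑-antisym x top (top-greatest x) (greatest top (top⊑ y≢x x⊑y) (top⊑ z≢x x⊑z)))
    where
    top⊑ : ∀ {v} → v ≢ x → x ⊑ v → top ⊑ v
    top⊑ {v} v≢x x⊑v = subst (top ⊑_) (sym (⋖-⊏-⊑⇒≡ x⋖top (x⊑v , ≢-sym v≢x) (top-greatest v))) (⊑-refl top)

  module Incomparability {x y} (x∥y : Incomparable x y) where

    x⊓y : Fin n
    x⊓y = proj₁ (meet x y)

    private
      x⊓y-meet : IsMeet R x y x⊓y
      x⊓y-meet = proj₂ (meet x y)

    x⊓y⊏x : x⊓y ⊏ x
    x⊓y⊏x = proj₁ x⊓y-meet , λ x⊓y≡x → proj₁ x∥y (subst (_⊑ y) x⊓y≡x (proj₁ (proj₂ x⊓y-meet)))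

    x⊓y⊏y : x⊓y ⊏ y
    x⊓y⊏y = proj₁ (proj₂ x⊓y-meet) , λ x⊓y≡y → proj₂ x∥y (subst (_⊑ x) x⊓y≡y (proj₁ x⊓y-meet))

    x⊓y-meetReducible : MeetReducible R x⊓y
    x⊓y-meetReducible = x , y , x⊓y-meet , ≢-sym (proj₂ x⊓y⊏x) , ≢-sym (proj₂ x⊓y⊏y)

    x⊓y≢top : x⊓y ≢ top
    x⊓y≢top x⊓y≡top = proj₂ x⊓y⊏x (⊑-antisym _ _ (proj₁ x⊓y⊏x) (subst (x ⊑_) (sym x⊓y≡top) (top-greatest x)))

    bot≢top : bot ≢ top
    bot≢top bot≡top = proj₁ x∥y (⊑-trans x top y (top-greatest x) (subst (_⊑ y) bot≡top (bot-least y)))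

    secondUpperCover : ∃ λ u → x⊓y ⋖ u × u ≢ upperCover x⊓y
    secondUpperCover with cover-between x⊓y⊏x | cover-between x⊓y⊏y
    ... | u , x⊓y⋖u , u⊑x | v , x⊓y⋖v , v⊑y with u ≟ upperCover x⊓y
    ...   | no u≢up  = u , x⊓y⋖u , u≢up
    ...   | yes u≡up = v , x⊓y⋖v , λ v≡up → u≢v (trans u≡up (sym v≡up))
      where
      u≢v : u ≢ v
      u≢v refl = proj₂ (proj₁ x⊓y⋖u) (⊑-antisym _ _ (proj₁ (proj₁ x⊓y⋖u)) (proj₂ (proj₂ x⊓y-meet) u u⊑x v⊑y))

  module CoverCounting {m} (covers : NumClasses (Covers R) _≡_ m) where

    private
      cover : Fin m → Fin n × Fin n
      cover = proj₁ covers

      cover-covers : ∀ i → Covers R (cover i)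
      cover-covers = proj₁ (proj₂ covers)

      cover-injective : Injective _≡_ _≡_ cover
      cover-injective = proj₁ (proj₂ (proj₂ covers)) _ _

      cover-exhaustive : ∀ p → Covers R p → ∃ λ i → p ≡ cover i
      cover-exhaustive = proj₂ (proj₂ (proj₂ covers))

      index : ∀ {p} → Covers R p → Fin m
      index {p} c = proj₁ (cover-exhaustive p c)

      index-injective : ∀ {p q} (cp : Covers R p) (cq : Covers R q) → index cp ≡ index cq → p ≡ q
      index-injective {p} {q} cp cq eq =
        trans (proj₂ (cover-exhaustive p cp)) (trans (cong cover eq) (sym (proj₂ (cover-exhaustive q cq))))

      upperCoverIndex : Fin n → Fin (suc m)
      upperCoverIndex x with x ≟ top
      ... | yes _    = zero
      ... | no x≢top = suc (index (⋖-upperCover x≢top))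

      upperCoverIndex-injective : Injective _≡_ _≡_ upperCoverIndex
      upperCoverIndex-injective {x} {y} eq with x ≟ top | y ≟ top
      ... | yes x≡top | yes y≡top = trans x≡top (sym y≡top)
      ... | no _      | no _      = cong proj₁ (index-injective _ _ (suc-injective eq))
      upperCoverIndex-injective {x} {y} () | yes _ | no _
      upperCoverIndex-injective {x} {y} () | no _  | yes _

    size≤1+covers : n ≤ suc m
    size≤1+covers = injective⇒≤ upperCoverIndex-injective

    incomparable⇒size≤covers : ∀ {x y} → Incomparable x y → n ≤ m
    incomparable⇒size≤covers x∥y = s≤s⁻¹ (injective∧missing⇒< upperCoverIndex-injective missing)
      where
      open Incomparability x∥y
      u = proj₁ secondUpperCover
      x⊓y⋖u = proj₁ (proj₂ secondUpperCover)
      missing : ∀ x → upperCoverIndex x ≢ suc (index x⊓y⋖u)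
      missing x eq with x ≟ top
      missing x () | yes _
      ... | no x≢top =
        proj₂ (proj₂ secondUpperCover) (trans (sym (cong proj₂ same)) (cong upperCover (cong proj₁ same)))
        where
        same : (x , upperCover x) ≡ (x⊓y , u)
        same = index-injective (⋖-upperCover x≢top) x⊓y⋖u (suc-injective eq)

    total⇒1+covers≤size : Total _⊑_ → suc m ≤ n
    total⇒1+covers≤size total = injective⇒≤ (∷-injective top-fresh lowerEnd-injective)
      where
      top-fresh : ∀ i → top ≢ proj₁ (cover i)
      top-fresh i top≡ = ⋖⇒≢top (cover-covers i) (sym top≡)
      sameLowerEnd : ∀ {p q} → Covers R p → Covers R q → proj₁ p ≡ proj₁ q → p ≡ q
      sameLowerEnd {x , y} {.x , y′} x⋖y x⋖y′ refl with total y y′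
      ... | inj₁ y⊑y′ = cong (x ,_) (⋖-⊏-⊑⇒≡ x⋖y′ (proj₁ x⋖y) y⊑y′)
      ... | inj₂ y′⊑y = cong (x ,_) (sym (⋖-⊏-⊑⇒≡ x⋖y (proj₁ x⋖y′) y′⊑y))
      lowerEnd-injective : Injective _≡_ _≡_ (proj₁ ∘ cover)
      lowerEnd-injective {i} {j} eq = cover-injective (sameLowerEnd (cover-covers i) (cover-covers j) eq)

    module _ (reducibles-comparable : ReduciblesComparable) where

      -- Injective on covers: a meet-irreducible element has a single upper cover, and
      -- the meet-reducible elements form a chain, so no two of them share an upper cover.
      endpoint : (p : Fin n × Fin n) → Dec (MeetReducible R (proj₁ p)) → Fin n ⊎ Fin n
      endpoint (_ , y) (yes _) = inj₂ y
      endpoint (x , _) (no _)  = inj₁ x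

      endpoint-injective : ∀ {p q} dp dq → Covers R p → Covers R q → endpoint p dp ≡ endpoint q dq → p ≡ q
      endpoint-injective {x , y} {x′ , .y} (yes mr) (yes mr′) x⋖y x′⋖y refl
        with reducibles-comparable x x′ (inj₂ mr) (inj₂ mr′)
      ... | inj₁ x⊑x′ = cong (_, y) (⋖-⊑-⊏⇒≡ x⋖y x⊑x′ (proj₁ x′⋖y))
      ... | inj₂ x′⊑x = cong (_, y) (sym (⋖-⊑-⊏⇒≡ x′⋖y x′⊑x (proj₁ x⋖y)))
      endpoint-injective {x , y} {.x , y′} (no ¬mr) (no _) x⋖y x⋖y′ refl with y ≟ y′
      ... | yes y≡y′ = cong (x ,_) y≡y′
      ... | no y≢y′  = ⊥-elim (¬mr (upperCovers-distinct⇒meetReducible x⋖y x⋖y′ y≢y′))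
      endpoint-injective (yes _) (no _)  _ _ ()
      endpoint-injective (no _)  (yes _) _ _ ()

      endpoint-inj₁ : ∀ {x y v} d → x ⋖ y → endpoint (x , y) d ≡ inj₁ v → ¬ MeetReducible R v × v ≢ top
      endpoint-inj₁ (no ¬mr) x⋖y refl = ¬mr , ⋖⇒≢top x⋖y
      endpoint-inj₁ (yes _)  _   ()

      endpoint-inj₂ : ∀ {x y v} d → x ⋖ y → endpoint (x , y) d ≡ inj₂ v → v ≢ bot × v ≢ top
      endpoint-inj₂ (yes mr) x⋖y refl = ⋖⇒≢bot x⋖y , λ { refl → meetReducible⇒¬⋖top mr x⋖y }
      endpoint-inj₂ (no _)   _   ()

      incomparable⇒4+covers≤2size : ∀ {x y} → Incomparable x y → 4 + m ≤ n + n
      incomparable⇒4+covers≤2size x∥y =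
        injective⇒≤ {f = Inverse.from +↔⊎ ∘ g} (λ eq → g-injective (to-injective (↔-sym +↔⊎) eq))
        where
        open Incomparability x∥y
        ends : Fin m → Fin n ⊎ Fin n
        ends i = endpoint (cover i) (meetReducible? _)
        ends-injective : Injective _≡_ _≡_ ends
        ends-injective {i} {j} eq =
          cover-injective (endpoint-injective (meetReducible? _) (meetReducible? _)
                                              (cover-covers i) (cover-covers j) eq)
        g : Fin (4 + m) → Fin n ⊎ Fin n
        g = inj₁ top ∷ inj₁ x⊓y ∷ inj₂ bot ∷ inj₂ top ∷ ends
        top₁-fresh : ∀ i → inj₁ top ≢ (inj₁ x⊓y ∷ inj₂ bot ∷ inj₂ top ∷ ends) i
        top₁-fresh zero                = x⊓y≢top ∘ sym ∘ inj₁-injective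
        top₁-fresh (suc zero)          ()
        top₁-fresh (suc (suc zero))    ()
        top₁-fresh (suc (suc (suc i))) eq = proj₂ (endpoint-inj₁ _ (cover-covers i) (sym eq)) refl
        x⊓y-fresh : ∀ i → inj₁ x⊓y ≢ (inj₂ bot ∷ inj₂ top ∷ ends) i
        x⊓y-fresh zero          ()
        x⊓y-fresh (suc zero)    ()
        x⊓y-fresh (suc (suc i)) eq = proj₁ (endpoint-inj₁ _ (cover-covers i) (sym eq)) x⊓y-meetReducible
        bot-fresh : ∀ i → inj₂ bot ≢ (inj₂ top ∷ ends) i
        bot-fresh zero    = bot≢top ∘ inj₂-injective
        bot-fresh (suc i) eq = proj₁ (endpoint-inj₂ _ (cover-covers i) (sym eq)) refl
        top₂-fresh : ∀ i → inj₂ top ≢ ends i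
        top₂-fresh i eq = proj₂ (endpoint-inj₂ _ (cover-covers i) (sym eq)) refl
        g-injective : Injective _≡_ _≡_ g
        g-injective = ∷-injective top₁-fresh (∷-injective x⊓y-fresh
                        (∷-injective bot-fresh (∷-injective top₂-fresh ends-injective)))

    total⇒excess≡0 : Total _⊑_ → ∀ {k} → m + 1 ≡ n + k → k ≡ 0
    total⇒excess≡0 total {k} eq = n≤0⇒n≡0 (+-cancelˡ-≤ n k 0 (begin
      n + k ≡⟨ eq ⟨
      m + 1 ≡⟨ +-comm m 1 ⟩
      suc m ≤⟨ total⇒1+covers≤size total ⟩
      n     ≡⟨ +-identityʳ n ⟨
      n + 0 ∎))
      where open ≤-Reasoning

    incomparable⇒excess≢0 : ∀ {x y} → Incomparable x y → m + 1 ≢ n + 0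
    incomparable⇒excess≢0 x∥y eq = 1+n≰n (begin
      suc m ≡⟨ +-comm 1 m ⟩
      m + 1 ≡⟨ eq ⟩
      n + 0 ≡⟨ +-identityʳ n ⟩
      n     ≤⟨ incomparable⇒size≤covers x∥y ⟩
      m     ∎)
      where open ≤-Reasoning

    rc⇒excess≤size∸3 : ReduciblesComparable → ∀ {k} → m + 1 ≡ n + k → k ≤ n ∸ 3
    rc⇒excess≤size∸3 rc {k} eq with total⊎incomparable
    ... | inj₁ total = subst (_≤ n ∸ 3) (sym (total⇒excess≡0 total eq)) z≤n
    ... | inj₂ (_ , _ , x∥y) = m+n≤o⇒m≤o∸n k (+-cancelˡ-≤ n (k + 3) n (begin
      n + (k + 3) ≡⟨ +-assoc n k 3 ⟨
      n + k + 3   ≡⟨ cong (_+ 3) eq ⟨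
      m + 1 + 3   ≡⟨ +-assoc m 1 3 ⟩
      m + 4       ≡⟨ +-comm m 4 ⟩
      4 + m       ≤⟨ incomparable⇒4+covers≤2size rc x∥y ⟩
      n + n       ∎))
      where open ≤-Reasoning

  hasNullity : ∃ (HasNullity R)
  hasNullity = suc m ∸ n , m , 1 , covers , oneComponent , (begin
      m + 1             ≡⟨ +-comm m 1 ⟩
      suc m             ≡⟨ m+[n∸m]≡n (CoverCounting.size≤1+covers covers) ⟨
      n + (suc m ∸ n)   ∎)
    where
    open ≡-Reasoning
    m = proj₁ coverCount
    covers = proj₂ coverCount

  nullity-equation : ∀ {k} → HasNullity R k → ∃ λ m → NumClasses (Covers R) _≡_ m × m + 1 ≡ n + k
  nullity-equation {k} (m , c , covers , components , eq) =
    m , covers ,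
    subst (λ c → m + c ≡ n + k) (numClasses-unique Connected-isEquivalence components oneComponent) eq

  total⇒nullity≡0 : Total _⊑_ → ∀ {k} → HasNullity R k → k ≡ 0
  total⇒nullity≡0 total h with m , covers , eq ← nullity-equation h =
    CoverCounting.total⇒excess≡0 covers total eq

  total⇒hasNullity0 : Total _⊑_ → HasNullity R 0
  total⇒hasNullity0 total = subst (HasNullity R) (total⇒nullity≡0 total (proj₂ hasNullity)) (proj₂ hasNullity)

  nullity≡0⇒total : HasNullity R 0 → Total _⊑_
  nullity≡0⇒total h with total⊎incomparable | nullity-equation h
  ... | inj₁ total         | _               = total
  ... | inj₂ (_ , _ , x∥y) | m , covers , eq = ⊥-elim (CoverCounting.incomparable⇒excess≢0 covers x∥y eq)

  rc⇒nullity≤size∸3 : ReduciblesComparable → ∀ {k} → HasNullity R k → k ≤ n ∸ 3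
  rc⇒nullity≤size∸3 rc h with m , covers , eq ← nullity-equation h =
    CoverCounting.rc⇒excess≤size∸3 covers rc eq

standardChain : ∀ {n} → Rel n
standardChain x y = ⌊ x Finₚ.≤? y ⌋

standardChain-isPartialOrder : ∀ {n} → IsPartialOrder (standardChain {n})
standardChain-isPartialOrder = record
  { refl    = λ _ → fromWitness Finₚ.≤-refl
  ; antisym = λ _ _ x≤y y≤x → Finₚ.≤-antisym (toWitness x≤y) (toWitness y≤x)
  ; trans   = λ _ _ _ x≤y y≤z → fromWitness (Finₚ.≤-trans (toWitness x≤y) (toWitness y≤z))
  }

standardChain-total : ∀ {n} → Total (_≼_ (standardChain {n}))
standardChain-total x y = Sum.map fromWitness fromWitness (Finₚ.≤-total x y)

module TotalOrder {n} {R : Rel n} (po : IsPartialOrder R) (total : Total (_≼_ R)) where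

  open Order R
  open Poset po

  isLattice : IsLattice R
  isLattice = record { isPartialOrder = po ; join = join ; meet = meet }
    where
    join : ∀ x y → ∃ (IsJoin R x y)
    join x y with total x y
    ... | inj₁ x⊑y = y , x⊑y , ⊑-refl y , λ _ _ y⊑u → y⊑u
    ... | inj₂ y⊑x = x , ⊑-refl x , y⊑x , λ _ x⊑u _ → x⊑u
    meet : ∀ x y → ∃ (IsMeet R x y)
    meet x y with total x y
    ... | inj₁ x⊑y = x , ⊑-refl x , x⊑y , λ _ l⊑x _ → l⊑x
    ... | inj₂ y⊑x = y , y⊑x , ⊑-refl y , λ _ _ l⊑y → l⊑y

  isRCLattice : IsRCLattice R
  isRCLattice = isLattice , λ x y _ _ → total x y

  strictlyBelow : Fin n → Subset n
  strictlyBelow x = tabulate (⌊_⌋ ∘ (_⊏? x))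

  rank : Fin n → ℕ
  rank x = ∣ strictlyBelow x ∣

  rank-strict : ∀ {x y} → x ⊏ y → rank x < rank y
  rank-strict {x} {y} x⊏y = p⊂q⇒∣p∣<∣q∣
    ( (λ z∈ → from below (⊏-trans (to below z∈) x⊏y))
    , x , from below x⊏y , (λ x∈ → irrefl refl (to below x∈)))
    where
    open Equivalence
    below = λ {z w} → ∈-tabulate-⌊⌋ (_⊏? w) {z}

  rank<size : ∀ x → rank x < n
  rank<size x = subst (rank x <_) (∣⊤∣≡n n)
    (p⊂q⇒∣p∣<∣q∣ ((λ _ → ∈⊤) , x , ∈⊤ , λ x∈ → irrefl refl (Equivalence.to (∈-tabulate-⌊⌋ (_⊏? x)) x∈)))

  rank-preserves : ∀ {x y} → x ⊑ y → rank x ≤ rank y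
  rank-preserves {x} {y} x⊑y with x ≟ y
  ... | yes refl = ≤-refl
  ... | no x≢y   = <⇒≤ (rank-strict (x⊑y , x≢y))

  rank-reflects : ∀ {x y} → rank x ≤ rank y → x ⊑ y
  rank-reflects {x} {y} rx≤ry with total x y
  ... | inj₁ x⊑y = x⊑y
  ... | inj₂ y⊑x with y ≟ x
  ...   | yes refl = y⊑x
  ...   | no y≢x   = ⊥-elim (<⇒≱ (rank-strict (y⊑x , y≢x)) rx≤ry)

  position : Fin n → Fin n
  position x = fromℕ< (rank<size x)

  toℕ-position : ∀ x → toℕ (position x) ≡ rank x
  toℕ-position x = toℕ-fromℕ< (rank<size x)

  position-injective : Injective _≡_ _≡_ position
  position-injective {x} {y} eq =
    ⊑-antisym x y (rank-reflects (≤-reflexive ranks≡)) (rank-reflects (≤-reflexive (sym ranks≡)))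
    where
    ranks≡ : rank x ≡ rank y
    ranks≡ = trans (sym (toℕ-position x)) (trans (cong toℕ eq) (toℕ-position y))

  ≅standardChain : Iso R standardChain
  ≅standardChain = injective⇒↔ position-injective , λ x y → T-injective
    (λ x⊑y → fromWitness (subst₂ _≤_ (sym (toℕ-position x)) (sym (toℕ-position y)) (rank-preserves x⊑y)))
    (λ px≤py → rank-reflects (subst₂ _≤_ (toℕ-position x) (toℕ-position y) (toWitness px≤py)))

module StandardChain {n} = TotalOrder (standardChain-isPartialOrder {n}) standardChain-total

module _ {n} (x₀ : Fin n) where

  rcLattice-nullity : ∀ {R : Rel n} → IsRCLattice R → ∃ λ k → HasNullity R k × k ≤ n ∸ 3
  rcLattice-nullity (L , reducibles-comparable) =
    proj₁ hasNullity , proj₂ hasNullity , rc⇒nullity≤size∸3 reducibles-comparable (proj₂ hasNullity)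
    where open FiniteLattice L x₀

  nullity0-oneClass : NumClasses (λ R → IsRCLattice R × HasNullity R 0) Iso 1
  nullity0-oneClass = numClasses-one {_~_ = Iso}
    (StandardChain.isRCLattice , FiniteLattice.total⇒hasNullity0 StandardChain.isLattice x₀ standardChain-total)
    λ R ((L , _) , nullity0) →
      TotalOrder.≅standardChain (IsLattice.isPartialOrder L) (FiniteLattice.nullity≡0⇒total L x₀ nullity0)

  rcClasses-byNullity : ∀ {b} → (∀ k → NumClasses (λ R → IsRCLattice R × HasNullity R k) Iso (b k)) →
    NumClasses IsRCLattice Iso (b 0 + sum1to (n ∸ 3) b)
  rcClasses-byNullity #nullity =
    numClasses-⇔ {_~_ = Iso} (λ R → mk⇔ [ proj₁ , proj₁ ∘ proj₂ ∘ proj₂ ]′ λ rc → split rc (rcLattice-nullity rc))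
      (numClasses-⊎ Iso-isEquivalence (#nullity 0) (numClasses-⋃ Iso-isEquivalence #nullity disjoint (n ∸ 3))
        λ nullity0 (_ , _ , nullity1+k) iso → 0≢1+n (disjoint nullity0 nullity1+k iso))
    where
    disjoint : ∀ {k k′} {R S : Rel n} → IsRCLattice R × HasNullity R k → IsRCLattice S × HasNullity S k′ →
      Iso R S → k ≡ k′
    disjoint (_ , h) (_ , h′) iso = hasNullity-iso iso h h′
    Split : Rel n → Set
    Split R = (IsRCLattice R × HasNullity R 0) ⊎ ∃ λ k → k < n ∸ 3 × IsRCLattice R × HasNullity R (suc k)
    split : ∀ {R} → IsRCLattice R → (∃ λ k → HasNullity R k × k ≤ n ∸ 3) → Split R
    split rc (0     , h , _)     = inj₁ (rc , h)
    split rc (suc k , h , 1+k≤) = inj₂ (k , 1+k≤ , rc , h)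

mainTheorem8 : (n : ℕ) → 1 ≤ n → (a : ℕ) → (b : ℕ → ℕ) →
    NumClasses {Rel n} IsRCLattice Iso a →
    (∀ k → NumClasses {Rel n} (λ R → IsRCLattice R × HasNullity R k) Iso (b k)) →
    a ≡ 1 + sum1to (n ∸ 3) b
mainTheorem8 (suc n) _ a b #rc #nullity = begin
    a                          ≡⟨ numClasses-unique Iso-isEquivalence #rc (rcClasses-byNullity zero #nullity) ⟩
    b 0 + sum1to (suc n ∸ 3) b ≡⟨ cong (_+ sum1to (suc n ∸ 3) b) b0≡1 ⟩
    1 + sum1to (suc n ∸ 3) b   ∎
  where
  open ≡-Reasoning
  b0≡1 : b 0 ≡ 1
  b0≡1 = numClasses-unique Iso-isEquivalence (#nullity 0) (nullity0-oneClass zero)
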